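{- Consider the online interval scheduling problem with satisfaction-based profits (as defined in the context) with arbitrary job profits. For any number of machines $m \geq 2$, there does not exist a deterministic online algorithm whose competitive ratio is bounded.
   Context: There are $m$ identical machines. An input is a finite list of jobs; each job $J$ is a triple $(r(J), d(J), v(J))$ with release time $r(J)$, deadline $d(J) > r(J)$ and profit $v(J) > 0$. An algorithm assigns every job to one of the $m$ machines; any number of jobs may be assigned to the same machine and may overlap in time there. The profit of a job is distributed uniformly over its interval $[r(J), d(J)]$ and shared equally among the jobs on the same machine covering each point: if $J$ is on machine $a$ and $[r(J), d(J)]$ is split at all endpoints of intervals of jobs on machine $a$ into pieces $[x_i, x_{i+1}]$, $r(J) = x_1 < \dots < x_b = d(J)$, and $k_i$ is the number of jobs on machine $a$ whose intervals contain $(x_i, x_{i+1})$, then the algorithm gains $V(J) = \sum_{i=1}^{b-1} \frac{x_{i+1}-x_i}{d(J)-r(J)} \cdot \frac{v(J)}{k_i}$ from $J$; the profit of the algorithm on input $\sigma$ is the sum of $V(J)$ over all jobs, evaluated on the final schedule. In the online setting, jobs are revealed one at a time (not necessarily in order of release time), the total number of jobs is unknown, and each job must be irrevocably assigned to a machine before the next job is revealed (no preemption). An online algorithm $A$ is $c$-competitive if for every input $\sigma$ the profit of an optimal offline algorithm on $\sigma$ is at most $c$ times the profit of $A$ on $\sigma$. -}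

module Defs where

open import Data.Bool using (Bool; true; false; _∧_; not)
open import Data.Nat as ℕ using (ℕ; suc)
open import Data.Fin using (Fin; toℕ; _≟_)
open import Data.Integer using (+_)
open import Data.List using (List; []; _∷_; length; lookup; take; map; foldr; filterᵇ; deduplicate; allFin; cartesianProduct)
open import Data.Bool.ListAction using (any)
open import Data.Product using (_×_; _,_; proj₁; proj₂; ∃)
open import Data.Rational as ℚ using (ℚ; 0ℚ; _+_; _-_; _*_; _/_; _<_; _≤_; 1/_)
open import Data.Rational.Properties as ℚP using ()
open import Relation.Nullary using (¬_)
open import Relation.Binary.PropositionalEquality using (subst)
open import Relation.Nullary.Decidable using (⌊_⌋)

record Job : Set where
  constructor job
  field
    r   : ℚ
    d   : ℚ
    v   : ℚ
    r<d : r < d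
    v>0 : 0ℚ < v
open Job public

-- An input is a finite list of jobs, in order of revelation.
Input : Set
Input = List Job

Schedule : ℕ → Input → Set
Schedule m σ = Fin (length σ) → Fin m

sumℚ : List ℚ → ℚ
sumℚ = foldr _+_ 0ℚ

len-nonZero : (J : Job) → ℚ.NonZero (d J - r J)
len-nonZero J = ℚ.>-nonZero 0<len
  where
  0<len : 0ℚ < d J - r J
  0<len = subst (_< d J - r J) (ℚP.+-inverseʳ (r J)) (ℚP.+-monoˡ-< (ℚ.- r J) (r<d J))

-- The interval of J_i is split at all endpoints of jobs on the same machine
-- into elementary pieces [p,q] (consecutive distinct endpoints inside [r,d]);
-- on each piece J_i gains  (q - p)/(d - r) * v / k, where k is the number of
-- jobs on that machine whose interval contains (p,q)  (J_i itself included).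
jobProfit : ∀ {m} (σ : Input) → Schedule m σ → Fin (length σ) → ℚ
jobProfit {m} σ s i = sumℚ (map piece pieces)
  where
  J = lookup σ i
  sameMachine : Fin (length σ) → Bool
  sameMachine j = ⌊ s j ≟ s i ⌋
  onMachine : List (Fin (length σ))
  onMachine = filterᵇ sameMachine (allFin (length σ))
  points : List ℚ
  points = deduplicate ℚ._≟_
             (foldr (λ j acc → r (lookup σ j) ∷ d (lookup σ j) ∷ acc) [] onMachine)
  strictlyBetween : ℚ → ℚ → ℚ → Bool
  strictlyBetween p q x = ⌊ p ℚ.<? x ⌋ ∧ ⌊ x ℚ.<? q ⌋
  isPiece : ℚ × ℚ → Bool
  isPiece (p , q) = ⌊ r J ℚ.≤? p ⌋ ∧ ⌊ p ℚ.<? q ⌋ ∧ ⌊ q ℚ.≤? d J ⌋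
                    ∧ not (any (strictlyBetween p q) points)
  pieces : List (ℚ × ℚ)
  pieces = filterᵇ isPiece (cartesianProduct points points)
  cover : ℚ → ℚ → ℕ
  cover p q = length (filterᵇ (λ j → ⌊ r (lookup σ j) ℚ.≤? p ⌋ ∧ ⌊ q ℚ.≤? d (lookup σ j) ⌋) onMachine)
  piece : ℚ × ℚ → ℚ
  piece (p , q) with cover p q
  ... | ℕ.zero  = 0ℚ   -- impossible: J itself covers every piece
  ... | suc k   = ((q - p) * (ℚ.1/_ (d J - r J) {{len-nonZero J}})) * v J * ((+ 1) / suc k)

profit : ∀ {m} (σ : Input) → Schedule m σ → ℚ
profit σ s = sumℚ (map (jobProfit σ s) (allFin (length σ)))

-- Its own earlier
-- decisions are determined by the history, so this is fully general.
OnlineAlg : ℕ → Set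
OnlineAlg m = List Job → Job → Fin m

run : ∀ {m} → OnlineAlg m → (σ : Input) → Schedule m σ
run A σ i = A (take (toℕ i) σ) (lookup σ i)

-- A is c-competitive: for every input, every (in particular an optimal)
-- offline schedule earns at most c times the profit of A.
Competitive : ∀ {m} → OnlineAlg m → ℚ → Set
Competitive {m} A c = ∀ (σ : Input) (s : Schedule m σ) → profit σ s ≤ c * profit σ (run A σ)

-- Given A and a candidate ratio c, let
-- C = natBound c ≥ c and K = 2C + 1.  The adversary reveals unit jobs
-- [0, 1], the t-th of value (K + 1)^t.  By a generalised pigeonhole principle
-- some job n is placed by A on a machine already holding K − 1 jobs; stop after
-- job n.  All jobs share the single piece [0, 1], so a job on a machine with
-- k + 1 jobs earns value/(k + 1).  Hence
--   * K·ALG ≤ K·Σ_{t<n} (K+1)^t + (K+1)^n ≤ 2·(K+1)^n   (online side),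
--   * OPT ≥ (K+1)^n, by putting job n alone on a second machine,
-- and OPT ≤ c·ALG yields K·X ≤ C·2X for X = (K+1)^n ≥ 1, contradicting K = 2C + 1.
module Submission where

open import Defs
open import Algebra.Properties.CommutativeMonoid.Sum as MonoidSum using ()
open import Data.Bool using (Bool; true; false; _∧_; if_then_else_; T?)
open import Data.Empty using (⊥-elim)
open import Data.Fin as Fin using (Fin; toℕ; _≟_)
import Data.Fin.Properties as FinP
open import Data.Integer as ℤ using (+_; +≤+; +<+; -[1+_])
import Data.Integer.Properties as ℤP
open import Data.List using (List; []; _∷_; length; lookup; take; foldr; filter; filterᵇ; deduplicate; tabulate; allFin; applyUpTo)
open import Data.List.Membership.Propositional using (_∈_)
open import Data.List.Membership.Propositional.Properties using (∈-filter⁺; ∈-allFin)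
open import Data.List.Properties using (map-tabulate; length-applyUpTo; lookup-applyUpTo)
open import Data.List.Relation.Unary.Any using (here; there)
open import Data.Nat as ℕ using (ℕ; zero; suc; _+_; _*_; _^_; _≤_; _<_; z≤n; s≤s; s≤s⁻¹; _≤?_; _<?_)
import Data.Nat.Coprimality as Coprime
open import Data.Nat.Properties hiding (_≟_)
open import Data.Nat.Tactic.RingSolver using (solve-∀)
open import Data.Product using (∃; _,_; proj₁; proj₂)
open import Data.Rational as ℚ using (ℚ; 0ℚ; 1ℚ; mkℚ; *≤*; *<*)
import Data.Rational.Properties as ℚP
open import Data.Sum using (_⊎_; inj₁; inj₂)
open import Function using (_∘_)
open import Relation.Binary.Definitions using (DecidableEquality)
open import Relation.Binary.PropositionalEquality
open import Relation.Nullary using (¬_; ¬?; yes; no)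
open import Relation.Nullary.Decidable using (⌊_⌋; fromWitness)

-- The embedding ι : ℕ → ℚ.  The numeric bounds of the argument are natural
-- numbers; ι transports them to ℚ, where the profits live.
ι : ℕ → ℚ
ι n = mkℚ (+ n) 0 (Coprime.sym (Coprime.1-coprimeTo n))

ι-mono-≤ : ∀ {a b} → a ≤ b → ι a ℚ.≤ ι b
ι-mono-≤ {a} {b} a≤b =
  *≤* (subst₂ ℤ._≤_ (sym (ℤP.*-identityʳ (+ a))) (sym (ℤP.*-identityʳ (+ b))) (+≤+ a≤b))

ι-cancel-≤ : ∀ {a b} → ι a ℚ.≤ ι b → a ≤ b
ι-cancel-≤ {a} {b} (*≤* le) =
  ℤP.drop‿+≤+ (subst₂ ℤ._≤_ (ℤP.*-identityʳ (+ a)) (ℤP.*-identityʳ (+ b)) le)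

ι-mono-< : ∀ {a b} → a < b → ι a ℚ.< ι b
ι-mono-< {a} {b} a<b =
  *<* (subst₂ ℤ._<_ (sym (ℤP.*-identityʳ (+ a))) (sym (ℤP.*-identityʳ (+ b))) (+<+ a<b))

0≤ι : ∀ a → 0ℚ ℚ.≤ ι a
0≤ι a = ι-mono-≤ z≤n

ι-+ : ∀ a b → ι a ℚ.+ ι b ≡ ι (a + b)
ι-+ a b = trans (cong₂ (λ x y → (x ℤ.+ y) ℚ./ 1) (ℤP.*-identityʳ (+ a)) (ℤP.*-identityʳ (+ b)))
                (ℚP.↥p/↧p≡p (ι (a + b)))

ι-* : ∀ a b → ι a ℚ.* ι b ≡ ι (a * b)
ι-* a b = trans (cong (ℚ._/ 1) (sym (ℤP.pos-* a b))) (ℚP.↥p/↧p≡p (ι (a * b)))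

natBound : ℚ → ℕ
natBound c = ℤ.∣ ℚ.↥ c ∣

≤-natBound : ∀ c → c ℚ.≤ ι (natBound c)
≤-natBound (mkℚ (+ n) d _) =
  *≤* (subst₂ ℤ._≤_ (ℤP.pos-* n 1) (ℤP.pos-* n (suc d)) (+≤+ (*-monoʳ-≤ n (s≤s z≤n))))
≤-natBound (mkℚ -[1+ n ] d _) = *≤* ℤ.-≤+

-- share k = 1/(k+1): the fraction of its value a job keeps where it overlaps
-- with k other jobs of its machine (written exactly as in jobProfit).
share : ℕ → ℚ
share k = (+ 1) ℚ./ suc k

share-normal : ∀ k → share k ≡ mkℚ (+ 1) k (Coprime.1-coprimeTo (suc k))
share-normal k = ℚP.↥p/↧p≡p _

0≤share : ∀ k → 0ℚ ℚ.≤ share k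
0≤share k rewrite share-normal k = *≤* (+≤+ z≤n)

share≤1 : ∀ k → share k ℚ.≤ 1ℚ
share≤1 k rewrite share-normal k = *≤* (+≤+ (s≤s z≤n))

ι-suc*share : ∀ k → ι (suc k) ℚ.* share k ≡ 1ℚ
ι-suc*share k rewrite share-normal k = ℚP.*-inverseʳ (ι (suc k))

module _ (w : ℚ) (0≤w : 0ℚ ℚ.≤ w) where
  instance
    w-nonNeg : ℚ.NonNegative w
    w-nonNeg = ℚ.nonNegative 0≤w

  0≤portion : ∀ k → 0ℚ ℚ.≤ w ℚ.* share k
  0≤portion k = ℚP.≤-trans (ℚP.≤-reflexive (sym (ℚP.*-zeroʳ w))) (ℚP.*-monoˡ-≤-nonNeg w (0≤share k))

  portion≤whole : ∀ k → w ℚ.* share k ℚ.≤ w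
  portion≤whole k = ℚP.≤-trans (ℚP.*-monoˡ-≤-nonNeg w (share≤1 k)) (ℚP.≤-reflexive (ℚP.*-identityʳ w))

  crowdedPortion : ∀ K k → K ≤ suc k → ι K ℚ.* (w ℚ.* share k) ℚ.≤ w
  crowdedPortion K k K≤1+k = begin
    ι K ℚ.* (w ℚ.* share k)       ≤⟨ ℚP.*-monoʳ-≤-nonNeg (w ℚ.* share k) {{ℚ.nonNegative (0≤portion k)}} (ι-mono-≤ K≤1+k) ⟩
    ι (suc k) ℚ.* (w ℚ.* share k) ≡⟨ cong (ι (suc k) ℚ.*_) (ℚP.*-comm w (share k)) ⟩
    ι (suc k) ℚ.* (share k ℚ.* w) ≡⟨ ℚP.*-assoc (ι (suc k)) (share k) w ⟨
    ι (suc k) ℚ.* share k ℚ.* w   ≡⟨ cong (ℚ._* w) (ι-suc*share k) ⟩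
    1ℚ ℚ.* w                      ≡⟨ ℚP.*-identityˡ w ⟩
    w                             ∎
    where open ℚP.≤-Reasoning

unitJob : (w : ℚ) → 0ℚ ℚ.< w → Job
unitJob w 0<w = job 0ℚ 1ℚ w (ℚP.positive⁻¹ 1ℚ) 0<w

machineOf : ∀ {m} (σ : Input) → Schedule m σ → Fin (length σ) → List (Fin (length σ))
machineOf σ s i = filterᵇ (λ j → ⌊ s j ≟ s i ⌋) (allFin (length σ))

load : ∀ {m} (σ : Input) → Schedule m σ → Fin (length σ) → ℕ
load σ s i = length (machineOf σ s i)

-- Job i lies on its own machine, so its load is positive.
load-suc : ∀ {m} (σ : Input) (s : Schedule m σ) i → ∃ λ k → load σ s i ≡ suc k
load-suc σ s i = nonEmpty (∈-filter⁺ (λ j → T? ⌊ s j ≟ s i ⌋) (∈-allFin i) (fromWitness refl))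
  where
  nonEmpty : ∀ {A : Set} {x : A} {xs} → x ∈ xs → ∃ λ k → length xs ≡ suc k
  nonEmpty (here _)  = _ , refl
  nonEmpty (there _) = _ , refl

unitEndpoints : ℕ → List ℚ
unitEndpoints zero    = []
unitEndpoints (suc n) = 0ℚ ∷ 1ℚ ∷ unitEndpoints n

noInnerEndpoints : ∀ n →
  filter (λ x → ¬? (0ℚ ℚP.≟ x)) (filter (λ x → ¬? (1ℚ ℚP.≟ x)) (deduplicate ℚP._≟_ (unitEndpoints n))) ≡ []
noInnerEndpoints zero    = refl
noInnerEndpoints (suc n) rewrite noInnerEndpoints n = refl

-- On an input of unit jobs the only elementary piece is [0, 1], covered by
-- every job of the machine; so a job of value w and load k + 1 earns w * share k.
module UnitJobs {m : ℕ} (σ : Input) (s : Schedule m σ)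
                (w : Fin (length σ) → ℚ) (0<w : ∀ j → 0ℚ ℚ.< w j)
                (unit : ∀ j → lookup σ j ≡ unitJob (w j) (0<w j)) where

  endpoints : ∀ js → foldr (λ j acc → r (lookup σ j) ∷ d (lookup σ j) ∷ acc) [] js ≡ unitEndpoints (length js)
  endpoints []       = refl
  endpoints (j ∷ js) rewrite unit j = cong (λ xs → 0ℚ ∷ 1ℚ ∷ xs) (endpoints js)

  coverAll : ∀ js → length (filterᵇ (λ j → ⌊ r (lookup σ j) ℚ.≤? 0ℚ ⌋ ∧ ⌊ 1ℚ ℚ.≤? d (lookup σ j) ⌋) js) ≡ length js
  coverAll []       = refl
  coverAll (j ∷ js) rewrite unit j = cong suc (coverAll js)

  unitJobProfit : ∀ i k → load σ s i ≡ suc k → jobProfit σ s i ≡ w i ℚ.* share k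
  unitJobProfit i k load≡1+k
    rewrite unit i | endpoints (machineOf σ s i) | load≡1+k | noInnerEndpoints k
          | coverAll (machineOf σ s i) | load≡1+k | unit i
    = trans (ℚP.+-identityʳ _) (cong (ℚ._* share k) (ℚP.*-identityˡ (w i)))

sumTo : (ℕ → ℕ) → ℕ → ℕ
sumTo g zero    = 0
sumTo g (suc n) = g 0 + sumTo (g ∘ suc) n

sumTo-last : ∀ g n → sumTo g (suc n) ≡ sumTo g n + g n
sumTo-last g zero    = +-comm (g 0) 0
sumTo-last g (suc n) = trans (cong (_+_ (g 0)) (sumTo-last (g ∘ suc) n)) (sym (+-assoc (g 0) _ _))

term≤sumTo : ∀ g n → g n ≤ sumTo g (suc n)
term≤sumTo g n = subst (g n ≤_) (sym (sumTo-last g n)) (m≤n+m (g n) (sumTo g n))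

sumTo-cong : ∀ g h n → (∀ t → t < n → g t ≡ h t) → sumTo g n ≡ sumTo h n
sumTo-cong g h zero    g≗h = refl
sumTo-cong g h (suc n) g≗h =
  cong₂ _+_ (g≗h 0 (s≤s z≤n)) (sumTo-cong (g ∘ suc) (h ∘ suc) n (λ t t<n → g≗h (suc t) (s≤s t<n)))

sumTo-zero : ∀ n → sumTo (λ _ → 0) n ≡ 0
sumTo-zero zero    = refl
sumTo-zero (suc n) = sumTo-zero n

indicator : Bool → ℕ
indicator true  = 1
indicator false = 0

indicator-≡ : ∀ {A : Set} (_≟ᴬ_ : DecidableEquality A) {x y : A} → x ≡ y → indicator ⌊ x ≟ᴬ y ⌋ ≡ 1
indicator-≡ _≟ᴬ_ x≡y = cong (indicator ∘ ⌊_⌋) (≡-≟-identity _≟ᴬ_ x≡y)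

length-filterᵇ-tabulate : ∀ {A : Set} {L} (h : Fin L → A) (p : A → Bool) (q : ℕ → Bool) →
  (∀ j → p (h j) ≡ q (toℕ j)) → length (filterᵇ p (tabulate h)) ≡ sumTo (indicator ∘ q) L
length-filterᵇ-tabulate {L = zero}  h p q p≗q = refl
length-filterᵇ-tabulate {L = suc L} h p q p≗q rewrite p≗q Fin.zero with q 0
... | true  = cong suc (length-filterᵇ-tabulate (h ∘ Fin.suc) p (q ∘ suc) (p≗q ∘ Fin.suc))
... | false = length-filterᵇ-tabulate (h ∘ Fin.suc) p (q ∘ suc) (p≗q ∘ Fin.suc)

load-byRule : ∀ {m} (σ : Input) (s : Schedule m σ) (g : ℕ → Fin m) → (∀ j → s j ≡ g (toℕ j)) →
  ∀ i → load σ s i ≡ sumTo (λ t → indicator ⌊ g t ≟ g (toℕ i) ⌋) (length σ)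
load-byRule σ s g s≗g i =
  length-filterᵇ-tabulate (λ j → j) _ _ (λ j → cong₂ (λ a b → ⌊ a ≟ b ⌋) (s≗g j) (s≗g i))

sumℚ-mono : ∀ {L} (F G : Fin L → ℚ) → (∀ j → F j ℚ.≤ G j) → sumℚ (tabulate F) ℚ.≤ sumℚ (tabulate G)
sumℚ-mono {zero}  F G F≤G = ℚP.≤-refl
sumℚ-mono {suc L} F G F≤G = ℚP.+-mono-≤ (F≤G Fin.zero) (sumℚ-mono (F ∘ Fin.suc) (G ∘ Fin.suc) (F≤G ∘ Fin.suc))

sumℚ-scale : ∀ {L} (c : ℚ) (F : Fin L → ℚ) → c ℚ.* sumℚ (tabulate F) ≡ sumℚ (tabulate (λ j → c ℚ.* F j))
sumℚ-scale {zero}  c F = ℚP.*-zeroʳ c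
sumℚ-scale {suc L} c F =
  trans (ℚP.*-distribˡ-+ c (F Fin.zero) _) (cong (c ℚ.* F Fin.zero ℚ.+_) (sumℚ-scale c (F ∘ Fin.suc)))

sumℚ-ι : ∀ L (g : ℕ → ℕ) → sumℚ (tabulate {n = L} (λ j → ι (g (toℕ j)))) ≡ ι (sumTo g L)
sumℚ-ι zero    g = refl
sumℚ-ι (suc L) g = trans (cong (ι (g 0) ℚ.+_) (sumℚ-ι L (g ∘ suc))) (ι-+ (g 0) (sumTo (g ∘ suc) L))

profit-tabulate : ∀ {m} (σ : Input) (s : Schedule m σ) → profit σ s ≡ sumℚ (tabulate (jobProfit σ s))
profit-tabulate σ s = cong sumℚ (map-tabulate (λ j → j) (jobProfit σ s))

module Pigeonhole {m : ℕ} (f : ℕ → Fin m) where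
  open MonoidSum +-0-commutativeMonoid using (sum; ∑-distrib-+; sum-cong-≗; sum-replicate-zero)

  count : Fin m → ℕ → ℕ
  count a = sumTo (λ t → indicator ⌊ f t ≟ a ⌋)

  count-suc : ∀ a n → count a (suc n) ≡ count a n + indicator ⌊ f n ≟ a ⌋
  count-suc a = sumTo-last (λ t → indicator ⌊ f t ≟ a ⌋)

  -- Each step increments exactly one count.
  sum-indicator : ∀ {k} (b : Fin k) → sum (λ a → indicator ⌊ b ≟ a ⌋) ≡ 1
  sum-indicator {suc k} Fin.zero    = cong suc (sum-replicate-zero k)
  sum-indicator {suc k} (Fin.suc b) = trans (sum-cong-≗ shift) (sum-indicator b)
    where
    shift : ∀ a → indicator ⌊ Fin.suc b ≟ Fin.suc a ⌋ ≡ indicator ⌊ b ≟ a ⌋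
    shift a with b ≟ a
    ... | yes _ = refl
    ... | no  _ = refl

  count-total : ∀ n → sum (λ a → count a n) ≡ n
  count-total zero    = sum-replicate-zero m
  count-total (suc n) = begin
    sum (λ a → count a (suc n))                               ≡⟨ sum-cong-≗ (λ a → count-suc a n) ⟩
    sum (λ a → count a n + indicator ⌊ f n ≟ a ⌋)             ≡⟨ ∑-distrib-+ (λ a → count a n) _ ⟩
    sum (λ a → count a n) + sum (λ a → indicator ⌊ f n ≟ a ⌋) ≡⟨ cong₂ _+_ (count-total n) (sum-indicator (f n)) ⟩
    n + 1                                                     ≡⟨ +-comm n 1 ⟩
    suc n                                                     ∎
    where open ≡-Reasoning

  sum-mono : ∀ {k} (g h : Fin k → ℕ) → (∀ a → g a ≤ h a) → sum g ≤ sum h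
  sum-mono {zero}  g h g≤h = z≤n
  sum-mono {suc k} g h g≤h = +-mono-≤ (g≤h Fin.zero) (sum-mono (g ∘ Fin.suc) (h ∘ Fin.suc) (g≤h ∘ Fin.suc))

  sum-const : ∀ k K → sum {k} (λ _ → K) ≡ k * K
  sum-const zero    K = refl
  sum-const (suc k) K = cong (_+_ K) (sum-const k K)

  search : ∀ K n → (∃ λ t → K ≤ count (f t) t) ⊎ (∀ a → count a n ≤ K)
  search K zero = inj₂ (λ a → z≤n)
  search K (suc n) with search K n
  ... | inj₁ crowdedStep = inj₁ crowdedStep
  ... | inj₂ bounded with K ≤? count (f n) n
  ... | yes crowdedStep = inj₁ (n , crowdedStep)
  ... | no  roomy       = inj₂ step
    where
    step : ∀ a → count a (suc n) ≤ K
    step a rewrite count-suc a n with f n ≟ a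
    ... | yes refl = subst (_≤ K) (+-comm 1 (count (f n) n)) (≰⇒> roomy)
    ... | no  _    = subst (_≤ K) (sym (+-identityʳ (count a n))) (bounded a)

  -- After m·K + 1 steps the counts cannot all stay at most K.
  crowded : ∀ K → ∃ λ n → K ≤ count (f n) n
  crowded K with search K (suc (m * K))
  ... | inj₁ found   = found
  ... | inj₂ bounded = ⊥-elim (1+n≰n (begin
    suc (m * K)                       ≡⟨ count-total (suc (m * K)) ⟨
    sum (λ a → count a (suc (m * K))) ≤⟨ sum-mono _ _ bounded ⟩
    sum {m} (λ _ → K)                 ≡⟨ sum-const m K ⟩
    m * K                             ∎))
    where open ≤-Reasoning

take-applyUpTo : ∀ {A : Set} (f : ℕ → A) t n → t ≤ n → take t (applyUpTo f n) ≡ applyUpTo f t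
take-applyUpTo f zero    n       t≤n       = refl
take-applyUpTo f (suc t) (suc n) (s≤s t≤n) = cong (f 0 ∷_) (take-applyUpTo (f ∘ suc) t n t≤n)

-- The adversary: unit jobs revealed in order 0, 1, 2, …, the t-th of value
-- base^t with base = K + 1, so each job outweighs K times all earlier ones together.
module Adversary (K : ℕ) where

  base : ℕ
  base = suc K

  value : ℕ → ℚ
  value t = ι (base ^ t)

  0<value : ∀ t → 0ℚ ℚ.< value t
  0<value t = ι-mono-< (m^n>0 base t)

  advJob : ℕ → Job
  advJob t = unitJob (value t) (0<value t)

  prefix : ℕ → Input
  prefix = applyUpTo advJob

  length-prefix : ∀ N → length (prefix N) ≡ N
  length-prefix = length-applyUpTo advJob

  position< : ∀ N (j : Fin (length (prefix N))) → toℕ j < N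
  position< N j = subst (toℕ j <_) (length-prefix N) (FinP.toℕ<n j)

  geometric : ∀ n → sumTo (λ t → K * base ^ t) n + 1 ≡ base ^ n
  geometric zero    = refl
  geometric (suc n) = begin
    sumTo S (suc n) + 1          ≡⟨ cong (_+ 1) (sumTo-last S n) ⟩
    sumTo S n + K * base ^ n + 1 ≡⟨ regroup (sumTo S n) (K * base ^ n) ⟩
    sumTo S n + 1 + K * base ^ n ≡⟨ cong (_+ K * base ^ n) (geometric n) ⟩
    base ^ n + K * base ^ n      ∎
    where
    open ≡-Reasoning
    S : ℕ → ℕ
    S t = K * base ^ t
    regroup : ∀ a b → a + b + 1 ≡ a + 1 + b
    regroup = solve-∀

  prefixProfit : ∀ {m} N (s : Schedule m (prefix N)) j k →
    load (prefix N) s j ≡ suc k → jobProfit (prefix N) s j ≡ value (toℕ j) ℚ.* share k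
  prefixProfit N s = UnitJobs.unitJobProfit (prefix N) s (value ∘ toℕ) (0<value ∘ toℕ) (lookup-applyUpTo advJob N)

  prefixProfit-nonNeg : ∀ {m} N (s : Schedule m (prefix N)) j → 0ℚ ℚ.≤ jobProfit (prefix N) s j
  prefixProfit-nonNeg N s j with load-suc (prefix N) s j
  ... | k , load≡1+k rewrite prefixProfit N s j k load≡1+k = 0≤portion (value (toℕ j)) (0≤ι _) k

  profit-nonNeg : ∀ {m} N (s : Schedule m (prefix N)) → 0ℚ ℚ.≤ profit (prefix N) s
  profit-nonNeg N s = begin
    0ℚ                                                  ≡⟨ cong ι (sumTo-zero (length (prefix N))) ⟨
    ι (sumTo (λ _ → 0) (length (prefix N)))             ≡⟨ sumℚ-ι (length (prefix N)) (λ _ → 0) ⟨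
    sumℚ (tabulate {n = length (prefix N)} (λ _ → ι 0)) ≤⟨ sumℚ-mono _ _ (prefixProfit-nonNeg N s) ⟩
    sumℚ (tabulate (jobProfit (prefix N) s))            ≡⟨ profit-tabulate (prefix N) s ⟨
    profit (prefix N) s                                 ∎
    where open ℚP.≤-Reasoning

  isolating : ∀ {m} → ℕ → ℕ → Fin (suc (suc m))
  isolating n t = if ⌊ t ℕ.≟ n ⌋ then Fin.suc Fin.zero else Fin.zero

  isolatedLoad : ∀ {m} n (j : Fin (length (prefix (suc n)))) → toℕ j ≡ n →
    load (prefix (suc n)) (isolating {m} n ∘ toℕ) j ≡ 1
  isolatedLoad {m} n j j≡n = begin
    load σ (iso ∘ toℕ) j                                       ≡⟨ load-byRule σ (iso ∘ toℕ) iso (λ _ → refl) j ⟩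
    sumTo (λ t → indicator ⌊ iso t ≟ iso (toℕ j) ⌋) (length σ) ≡⟨ cong₂ (λ i L → sumTo (λ t → indicator ⌊ iso t ≟ iso i ⌋) L)
                                                                         j≡n (length-prefix (suc n)) ⟩
    sumTo alone (suc n)                                        ≡⟨ sumTo-last alone n ⟩
    sumTo alone n + alone n                                    ≡⟨ cong₂ _+_ (trans (sumTo-cong alone _ n others) (sumTo-zero n))
                                                                           (indicator-≡ _≟_ refl) ⟩
    1                                                          ∎
    where
    open ≡-Reasoning
    σ = prefix (suc n)
    iso : ℕ → Fin (suc (suc m))
    iso = isolating n
    alone : ℕ → ℕ
    alone t = indicator ⌊ iso t ≟ iso n ⌋
    others : ∀ t → t < n → alone t ≡ 0
    others t t<n rewrite ≢-≟-identity ℕ._≟_ (<⇒≢ t<n) | ≡-≟-identity ℕ._≟_ {n} refl = refl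

  isolatedProfit : ∀ {m} n (j : Fin (length (prefix (suc n)))) → toℕ j ≡ n →
    jobProfit (prefix (suc n)) (isolating {m} n ∘ toℕ) j ≡ value n
  isolatedProfit {m} n j j≡n = begin
    jobProfit (prefix (suc n)) s j ≡⟨ prefixProfit (suc n) s j 0 (isolatedLoad n j j≡n) ⟩
    value (toℕ j) ℚ.* share 0      ≡⟨ ℚP.*-identityʳ (value (toℕ j)) ⟩
    value (toℕ j)                  ≡⟨ cong value j≡n ⟩
    value n                        ∎
    where
    open ≡-Reasoning
    s = isolating {m} n ∘ toℕ

  offlineBound : ℕ → ℕ → ℕ
  offlineBound n t = if ⌊ t ℕ.≟ n ⌋ then base ^ n else 0

  offlineBound-total : ∀ n → base ^ n ≤ sumTo (offlineBound n) (suc n)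
  offlineBound-total n = subst (_≤ sumTo (offlineBound n) (suc n)) last (term≤sumTo (offlineBound n) n)
    where
    last : offlineBound n n ≡ base ^ n
    last rewrite ≡-≟-identity ℕ._≟_ {n} refl = refl

  optBound : ∀ {m} n → value n ℚ.≤ profit (prefix (suc n)) (isolating {m} n ∘ toℕ)
  optBound {m} n = begin
    ι (base ^ n)                                     ≤⟨ ι-mono-≤ (offlineBound-total n) ⟩
    ι (sumTo bound (suc n))                          ≡⟨ cong (ι ∘ sumTo bound) (length-prefix (suc n)) ⟨
    ι (sumTo bound (length σ))                       ≡⟨ sumℚ-ι (length σ) bound ⟨
    sumℚ (tabulate {n = length σ} (ι ∘ bound ∘ toℕ)) ≤⟨ sumℚ-mono _ _ each ⟩
    sumℚ (tabulate (jobProfit σ s))                  ≡⟨ profit-tabulate σ s ⟨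
    profit σ s                                       ∎
    where
    open ℚP.≤-Reasoning
    σ = prefix (suc n)
    s : Schedule (suc (suc m)) σ
    s = isolating n ∘ toℕ
    bound = offlineBound n
    byCases : ∀ t (x : ℚ) → (t ≡ n → value n ℚ.≤ x) → 0ℚ ℚ.≤ x → ι (bound t) ℚ.≤ x
    byCases t x isolated nonNeg with t ℕ.≟ n
    ... | yes t≡n = isolated t≡n
    ... | no  _   = nonNeg
    each : ∀ j → ι (bound (toℕ j)) ℚ.≤ jobProfit σ s j
    each j = byCases (toℕ j) (jobProfit σ s j)
                     (λ j≡n → ℚP.≤-reflexive (sym (isolatedProfit n j j≡n)))
                     (prefixProfit-nonNeg (suc n) s j)

  onlineBound : ℕ → ℕ → ℕ
  onlineBound n t = if ⌊ t <? n ⌋ then K * base ^ t else base ^ n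

  onlineBound-total : ∀ n → sumTo (onlineBound n) (suc n) ≤ base ^ n + base ^ n
  onlineBound-total n = begin
    sumTo (onlineBound n) (suc n)             ≡⟨ sumTo-last (onlineBound n) n ⟩
    sumTo (onlineBound n) n + onlineBound n n ≡⟨ cong₂ _+_ (sumTo-cong (onlineBound n) _ n earlier) last ⟩
    sumTo (λ t → K * base ^ t) n + base ^ n   ≤⟨ +-monoˡ-≤ (base ^ n) (subst (sumTo (λ t → K * base ^ t) n ≤_)
                                                                            (geometric n) (m≤m+n _ 1)) ⟩
    base ^ n + base ^ n                       ∎
    where
    open ≤-Reasoning
    earlier : ∀ t → t < n → onlineBound n t ≡ K * base ^ t
    earlier t t<n with t <? n
    ... | yes _   = refl
    ... | no  t≮n = ⊥-elim (t≮n t<n)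
    last : onlineBound n n ≡ base ^ n
    last with n <? n
    ... | yes n<n = ⊥-elim (<-irrefl refl n<n)
    ... | no  _   = refl

  module Online {m : ℕ} (A : OnlineAlg m) where

    decision : ℕ → Fin m
    decision t = A (prefix t) (advJob t)

    open Pigeonhole decision public using (count; crowded)

    run-prefix : ∀ N (j : Fin (length (prefix N))) → run A (prefix N) j ≡ decision (toℕ j)
    run-prefix N j = cong₂ A (take-applyUpTo advJob (toℕ j) N (<⇒≤ (position< N j))) (lookup-applyUpTo advJob N j)

    lastLoad : ∀ n (j : Fin (length (prefix (suc n)))) → toℕ j ≡ n →
      load (prefix (suc n)) (run A (prefix (suc n))) j ≡ suc (count (decision n) n)
    lastLoad n j j≡n = begin
      load σ (run A σ) j                                         ≡⟨ load-byRule σ (run A σ) decision (run-prefix (suc n)) j ⟩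
      sumTo (λ t → indicator ⌊ decision t ≟ decision (toℕ j) ⌋) (length σ)
                                                                 ≡⟨ cong₂ (λ i L → sumTo (λ t → indicator ⌊ decision t ≟ decision i ⌋) L)
                                                                          j≡n (length-prefix (suc n)) ⟩
      count (decision n) (suc n)                                 ≡⟨ sumTo-last (λ t → indicator ⌊ decision t ≟ decision n ⌋) n ⟩
      count (decision n) n + indicator ⌊ decision n ≟ decision n ⌋ ≡⟨ cong (_+_ (count (decision n) n)) (indicator-≡ _≟_ refl) ⟩
      count (decision n) n + 1                                   ≡⟨ +-comm _ 1 ⟩
      suc (count (decision n) n)                                 ∎
      where
      open ≡-Reasoning
      σ = prefix (suc n)

    algBound : ∀ n → K ≤ suc (count (decision n) n) →
      ι K ℚ.* profit (prefix (suc n)) (run A (prefix (suc n))) ℚ.≤ ι (base ^ n + base ^ n)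
    algBound n crowdedAtn = begin
      ι K ℚ.* profit σ s                               ≡⟨ cong (ι K ℚ.*_) (profit-tabulate σ s) ⟩
      ι K ℚ.* sumℚ (tabulate (jobProfit σ s))          ≡⟨ sumℚ-scale (ι K) (jobProfit σ s) ⟩
      sumℚ (tabulate (λ j → ι K ℚ.* jobProfit σ s j))   ≤⟨ sumℚ-mono _ _ each ⟩
      sumℚ (tabulate {n = length σ} (ι ∘ bound ∘ toℕ)) ≡⟨ sumℚ-ι (length σ) bound ⟩
      ι (sumTo bound (length σ))                       ≡⟨ cong (ι ∘ sumTo bound) (length-prefix (suc n)) ⟩
      ι (sumTo bound (suc n))                          ≤⟨ ι-mono-≤ (onlineBound-total n) ⟩
      ι (base ^ n + base ^ n)                          ∎
      where
      open ℚP.≤-Reasoning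
      σ = prefix (suc n)
      s = run A σ
      bound = onlineBound n
      byCases : ∀ t (x : ℚ) → (t < n → x ℚ.≤ ι (K * base ^ t)) → (¬ t < n → x ℚ.≤ value n) → x ℚ.≤ ι (bound t)
      byCases t x early late with t <? n
      ... | yes t<n = early t<n
      ... | no  t≮n = late t≮n
      each : ∀ j → ι K ℚ.* jobProfit σ s j ℚ.≤ ι (bound (toℕ j))
      each j with load-suc σ s j
      ... | k , load≡1+k rewrite prefixProfit (suc n) s j k load≡1+k = byCases (toℕ j) _ early late
        where
        early : toℕ j < n → ι K ℚ.* (value (toℕ j) ℚ.* share k) ℚ.≤ ι (K * base ^ toℕ j)
        early _ = ℚP.≤-trans (ℚP.*-monoˡ-≤-nonNeg (ι K) {{ℚ.nonNegative (0≤ι K)}} (portion≤whole (value (toℕ j)) (0≤ι _) k))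
                             (ℚP.≤-reflexive (ι-* K (base ^ toℕ j)))
        late : ¬ toℕ j < n → ι K ℚ.* (value (toℕ j) ℚ.* share k) ℚ.≤ value n
        late j≮n = subst (λ i → ι K ℚ.* (value i ℚ.* share k) ℚ.≤ value n) (sym j≡n)
                     (crowdedPortion (value n) (0≤ι _) K k (subst (K ≤_) loads crowdedAtn))
          where
          j≡n : toℕ j ≡ n
          j≡n = ≤-antisym (s≤s⁻¹ (position< (suc n) j)) (≮⇒≥ j≮n)
          loads : suc (count (decision n) n) ≡ suc k
          loads = trans (sym (lastLoad n j j≡n)) load≡1+k

ratioBound : ∀ (c alg opt : ℚ) K X → 0ℚ ℚ.≤ alg → ι X ℚ.≤ opt → opt ℚ.≤ c ℚ.* alg →
  ι K ℚ.* alg ℚ.≤ ι (X + X) → K * X ≤ natBound c * (X + X)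
ratioBound c alg opt K X 0≤alg X≤opt opt≤c*alg K*alg≤2X = ι-cancel-≤ (begin
  ι (K * X)             ≡⟨ ι-* K X ⟨
  ι K ℚ.* ι X           ≤⟨ ℚP.*-monoˡ-≤-nonNeg (ι K) (ℚP.≤-trans X≤opt opt≤c*alg) ⟩
  ι K ℚ.* (c ℚ.* alg)   ≤⟨ ℚP.*-monoˡ-≤-nonNeg (ι K) (ℚP.*-monoʳ-≤-nonNeg alg (≤-natBound c)) ⟩
  ι K ℚ.* (ι C ℚ.* alg) ≡⟨ ℚP.*-assoc (ι K) (ι C) alg ⟨
  ι K ℚ.* ι C ℚ.* alg   ≡⟨ cong (ℚ._* alg) (ℚP.*-comm (ι K) (ι C)) ⟩
  ι C ℚ.* ι K ℚ.* alg   ≡⟨ ℚP.*-assoc (ι C) (ι K) alg ⟩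
  ι C ℚ.* (ι K ℚ.* alg) ≤⟨ ℚP.*-monoˡ-≤-nonNeg (ι C) K*alg≤2X ⟩
  ι C ℚ.* ι (X + X)     ≡⟨ ι-* C (X + X) ⟩
  ι (C * (X + X))       ∎)
  where
  open ℚP.≤-Reasoning
  C = natBound c
  instance
    ι-nonNeg : ∀ {n} → ℚ.NonNegative (ι n)
    ι-nonNeg {n} = ℚ.nonNegative (0≤ι n)
    alg-nonNeg : ℚ.NonNegative alg
    alg-nonNeg = ℚ.nonNegative 0≤alg

doubledBoundFails : ∀ C X → 1 ≤ X → ¬ (suc (C + C) * X ≤ C * (X + X))
doubledBoundFails C X 1≤X tooSmall =
  <-irrefl refl (≤-trans (+-monoˡ-≤ ((C + C) * X) 1≤X) (subst (X + (C + C) * X ≤_) (regroup C X) tooSmall))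
  where
  regroup : ∀ a b → a * (b + b) ≡ (a + a) * b
  regroup = solve-∀

mainTheorem2 : (m : ℕ) → 2 ≤ m → (A : OnlineAlg m) → ¬ (∃ λ c → Competitive A c)
mainTheorem2 zero          ()
mainTheorem2 (suc zero)    (s≤s ())
mainTheorem2 (suc (suc m)) _ A (c , competitive) =
  doubledBoundFails C (base ^ n) (m^n>0 base n)
    (ratioBound c (profit σ (run A σ)) (profit σ offline) K (base ^ n)
                (profit-nonNeg (suc n) (run A σ))
                (optBound n)
                (competitive σ offline)
                (algBound n (s≤s crowdedAtn)))
  where
  C = natBound c
  K = suc (C + C)
  open Adversary K
  open Online A
  n = proj₁ (crowded (C + C))
  crowdedAtn = proj₂ (crowded (C + C))
  σ = prefix (suc n)
  offline = isolating {m} n ∘ toℕ
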